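{- Let $\ell$ be prime, $n \geq 1$, and $r,s$ integers with $0 \le r,s \le n$ and $r+s \le n$. Let $G \le \mathrm{GL}_2(\mathbf{Z}/\ell^n)$ be the reduction modulo $\ell^n$ of $G_\ell(n;r,s)$. Then $\Gamma_G$ has no irregular cusps, except possibly when $\ell^n = 4$ and $rs = 0$.
   Context: $G_\ell(n;r,s)=\begin{pmatrix}1+\ell^r\mathbf{Z}_\ell&\ell^s\mathbf{Z}_\ell\\ \ell^{n-s}\mathbf{Z}_\ell&1+\ell^{n-r}\mathbf{Z}_\ell\end{pmatrix}\le\mathrm{GL}_2(\mathbf{Z}_\ell)$ with $1+\ell^0\mathbf{Z}_\ell:=\mathbf{Z}_\ell^\times$. For $G\le\mathrm{GL}_2(\mathbf{Z}/N)$, $\Gamma_G=\pi_N^{ -1}(G\cap\mathrm{SL}_2(\mathbf{Z}/N))$ where $\pi_N\colon\mathrm{SL}_2(\mathbf{Z})\to\mathrm{SL}_2(\mathbf{Z}/N)$ is reduction. For a finite-index $\Gamma\le\mathrm{SL}_2(\mathbf{Z})$: if $-1\in\Gamma$ all cusps are regular; otherwise a cusp $s$ is irregular if, for $\alpha\in\mathrm{SL}_2(\mathbf{Z})$ with $\alpha(\infty)=s$, the stabilizer of $\infty$ in $\alpha^{ -1}\Gamma\alpha$ is generated by $-\begin{pmatrix}1&h\\0&1\end{pmatrix}$ for some $h\in\mathbf{Z}_{>0}$. -}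

module Defs where

open import Data.Nat as ℕ using (ℕ; zero; suc)
open import Data.Integer as ℤ using (ℤ; +_; -_; _-_)
open import Data.Integer.Divisibility using (_∣_)
open import Data.Product using (Σ; _×_; ∃-syntax)
open import Data.Sum using (_⊎_)
open import Relation.Nullary using (¬_)
open import Relation.Binary.PropositionalEquality using (_≡_)

record M2 : Set where
  constructor mat
  field
    a b c d : ℤ
open M2 public

det : M2 → ℤ
det (mat a b c d) = a ℤ.* d ℤ.- b ℤ.* c

_·_ : M2 → M2 → M2
mat a b c d · mat a' b' c' d' =
  mat (a ℤ.* a' ℤ.+ b ℤ.* c') (a ℤ.* b' ℤ.+ b ℤ.* d')
      (c ℤ.* a' ℤ.+ d ℤ.* c') (c ℤ.* b' ℤ.+ d ℤ.* d')

I₂ : M2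
I₂ = mat (+ 1) (+ 0) (+ 0) (+ 1)

negI : M2
negI = mat (- + 1) (+ 0) (+ 0) (- + 1)

-- inverse of a determinant-1 matrix (adjugate)
inv : M2 → M2
inv (mat a b c d) = mat d (- b) (- c) a

_^ᴹ_ : M2 → ℕ → M2
g ^ᴹ zero = I₂
g ^ᴹ suc k = g · (g ^ᴹ k)

negT : ℕ → M2
negT h = mat (- + 1) (- + h) (+ 0) (- + 1)

-- Möbius action: γ(∞) = a/c, which equals ∞ iff c = 0
Fixes∞ : M2 → Set
Fixes∞ γ = c γ ≡ + 0

InCyclic : M2 → M2 → Set
InCyclic g γ = ∃[ m ] (γ ≡ g ^ᴹ m ⊎ γ ≡ inv g ^ᴹ m)

-- The cusp α(∞) (α ∈ SL₂(ℤ)) of Γ is irregular iff -1 ∉ Γ and the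
-- stabilizer of ∞ in α⁻¹Γα is generated by -(1 h ; 0 1) for some h > 0.
IrregularCusp : (M2 → Set) → M2 → Set
IrregularCusp Γ α =
  ¬ Γ negI ×
  Σ ℕ (λ h → (0 ℕ.< h) ×
    ((γ : M2) → det γ ≡ + 1 →
      ((Γ (α · (γ · inv α)) × Fixes∞ γ) → InCyclic (negT h) γ) ×
      (InCyclic (negT h) γ → (Γ (α · (γ · inv α)) × Fixes∞ γ))))

-- x ∈ 1 + ℓ^k ℤ_ℓ (read mod ℓ^n, k ≤ n), with 1 + ℓ^0 ℤ_ℓ := ℤ_ℓ^×
DiagCond : ℕ → ℕ → ℤ → Set
DiagCond ℓ zero x = ¬ (+ ℓ ∣ x)
DiagCond ℓ (suc k) x = + (ℓ ℕ.^ suc k) ∣ (x - + 1)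

-- x ∈ ℓ^k ℤ_ℓ (read mod ℓ^n, k ≤ n)
OffCond : ℕ → ℕ → ℤ → Set
OffCond ℓ k x = + (ℓ ℕ.^ k) ∣ x

-- Membership of (the residue class mod ℓ^n of) an integer matrix in the
-- reduction mod ℓ^n of G_ℓ(n; r, s): entries satisfy the congruence
-- conditions and the matrix is invertible mod ℓ^n.
InG : (ℓ n r s : ℕ) → M2 → Set
InG ℓ n r s (mat a b c d) =
  DiagCond ℓ r a × OffCond ℓ s b × OffCond ℓ (n ℕ.∸ s) c ×
  DiagCond ℓ (n ℕ.∸ r) d × ¬ (+ ℓ ∣ (a ℤ.* d ℤ.- b ℤ.* c))

-- Γ_G = π_{ℓ^n}^{-1}(G ∩ SL₂(ℤ/ℓ^n))
ΓG : (ℓ n r s : ℕ) → M2 → Set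
ΓG ℓ n r s γ = det γ ≡ + 1 × InG ℓ n r s γ

{-# OPTIONS --safe #-}
module Submission where

-- If the cusp α(∞) is irregular then γ = α(−T^h)α⁻¹ lies in Γ_G although −1 does not.
-- Such γ has determinant 1 and trace −2, so with y = a + 1 we get bc = −y², and the
-- off-diagonal conditions give ℓⁿ ∣ y². Since r ≥ k or n − r ≥ k whenever 2k ≤ n + 1,
-- one diagonal entry is ≡ 1 mod ℓᵏ, i.e. y ≡ ±2 mod ℓᵏ. Taking k = 1 forces ℓ = 2;
-- for n ≥ 3, k = 2 gives y ≡ 2 mod 4, contradicting 8 ∣ y². For ℓ = 2 and n ≤ 2,
-- outside the exceptional case, r ≤ 1 and n − r ≤ 1, and then −1 ∈ Γ_G after all.

open import Defs
open import Data.Nat using (ℕ; _≤_; _+_; _*_; _^_)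
open import Data.Nat.Primality using (Prime)
open import Data.Integer using (+_)
open import Data.Product using (_×_)
open import Relation.Nullary using (¬_)
open import Relation.Binary.PropositionalEquality using (_≡_)

open import Data.Nat as ℕ using (zero; suc; z≤n; s≤s; _∸_; _≤?_)
open import Data.Nat.Properties as ℕ using (≰⇒>)
import Data.Nat.Divisibility as ℕ
open import Data.Nat.Primality using (euclidsLemma; ¬prime[1]; irreducible[2])
open import Data.Integer as ℤ using (ℤ; -_; _-_)
import Data.Integer.Properties as ℤ
open import Data.Integer.Divisibility.Signed
open import Data.Integer.Tactic.RingSolver using (solve; solve-∀)
open import Data.List using (_∷_; [])
open import Data.Product as Product using (_,_; proj₁; proj₂)
open import Data.Sum as Sum using (_⊎_; inj₁; inj₂)
open import Data.Empty using (⊥-elim)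
open import Relation.Nullary using (yes; no)
open import Relation.Binary.PropositionalEquality
  using (refl; sym; trans; cong; subst; subst₂; module ≡-Reasoning)

trace : M2 → ℤ
trace γ = a γ ℤ.+ d γ

trace-conj : ∀ α g → trace (α · (g · inv α)) ≡ det α ℤ.* trace g
trace-conj (mat p q r t) (mat x y z w) = expanded p q r t x y z w
  where
  expanded : ∀ p q r t x y z w →
    p ℤ.* (x ℤ.* t ℤ.+ y ℤ.* - r) ℤ.+ q ℤ.* (z ℤ.* t ℤ.+ w ℤ.* - r)
      ℤ.+ (r ℤ.* (x ℤ.* - q ℤ.+ y ℤ.* p) ℤ.+ t ℤ.* (z ℤ.* - q ℤ.+ w ℤ.* p))
    ≡ (p ℤ.* t - q ℤ.* r) ℤ.* (x ℤ.+ w)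
  expanded = solve-∀

·-identityʳ : ∀ g → g · I₂ ≡ g
·-identityʳ (mat x y z w)
  rewrite ℤ.*-identityʳ x | ℤ.*-identityʳ y | ℤ.*-identityʳ z | ℤ.*-identityʳ w
        | ℤ.*-zeroʳ x | ℤ.*-zeroʳ y | ℤ.*-zeroʳ z | ℤ.*-zeroʳ w
        | ℤ.+-identityʳ x | ℤ.+-identityˡ y | ℤ.+-identityʳ z | ℤ.+-identityˡ w = refl

det-negT : ∀ h → det (negT h) ≡ + 1
det-negT h = cong (λ t → + 1 - t) (ℤ.*-zeroʳ (- + h))

negT∈⟨negT⟩ : ∀ h → InCyclic (negT h) (negT h)
negT∈⟨negT⟩ h = 1 , inj₁ (sym (·-identityʳ (negT h)))

b*c≡-[a+1]² : ∀ γ → det γ ≡ + 1 → trace γ ≡ - + 2 →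
  b γ ℤ.* c γ ≡ - ((a γ ℤ.+ + 1) ℤ.* (a γ ℤ.+ + 1))
b*c≡-[a+1]² (mat A B C D) det≡1 tr≡-2 = begin
  B ℤ.* C                                ≡⟨ solve (A ∷ B ∷ C ∷ D ∷ []) ⟩
  A ℤ.* D - (A ℤ.* D - B ℤ.* C)          ≡⟨ cong (λ t → A ℤ.* D - t) det≡1 ⟩
  A ℤ.* D - + 1                          ≡⟨ solve (A ∷ D ∷ []) ⟩
  A ℤ.* ((A ℤ.+ D) - A) - + 1            ≡⟨ cong (λ t → A ℤ.* (t - A) - + 1) tr≡-2 ⟩
  A ℤ.* (- + 2 - A) - + 1                ≡⟨ solve (A ∷ []) ⟩
  - ((A ℤ.+ + 1) ℤ.* (A ℤ.+ + 1))        ∎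
  where open ≡-Reasoning

^-monoʳ-∣ : ∀ m {j k} → j ≤ k → m ^ j ℕ.∣ m ^ k
^-monoʳ-∣ m {j} {k} j≤k = ℕ.divides (m ^ (k ∸ j)) (begin
  m ^ k               ≡⟨ cong (m ^_) (sym (ℕ.m∸n+n≡m j≤k)) ⟩
  m ^ (k ∸ j + j)     ≡⟨ ℕ.^-distribˡ-+-* m (k ∸ j) j ⟩
  m ^ (k ∸ j) * m ^ j ∎)
  where open ≡-Reasoning

k≤r⊎k≤n∸r : ∀ {k n} r → k + k ≤ suc n → k ≤ r ⊎ k ≤ n ∸ r
k≤r⊎k≤n∸r {k} {n} r 2k≤1+n with k ≤? r
... | yes k≤r = inj₁ k≤r
... | no k≰r = inj₂ (ℕ.m+n≤o⇒m≤o∸n k (ℕ.s≤s⁻¹ (begin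
  suc (k + r) ≡⟨ sym (ℕ.+-suc k r) ⟩
  k + suc r   ≤⟨ ℕ.+-monoʳ-≤ k (≰⇒> k≰r) ⟩
  k + k       ≤⟨ 2k≤1+n ⟩
  suc n       ∎)))
  where open ℕ.≤-Reasoning

offConds⇒ℓ^n∣* : ∀ {ℓ n s x y} → s ≤ n → OffCond ℓ s x → OffCond ℓ (n ∸ s) y →
  + (ℓ ^ n) ∣ x ℤ.* y
offConds⇒ℓ^n∣* {ℓ} {n} {s} {x} {y} s≤n ℓ^s∣x ℓ^[n∸s]∣y =
  ∣ᵤ⇒∣ (subst₂ ℕ._∣_ ℓ^s*ℓ^[n∸s]≡ℓ^n (sym (ℤ.abs-* x y)) (ℕ.*-pres-∣ ℓ^s∣x ℓ^[n∸s]∣y))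
  where
  ℓ^s*ℓ^[n∸s]≡ℓ^n : ℓ ^ s * ℓ ^ (n ∸ s) ≡ ℓ ^ n
  ℓ^s*ℓ^[n∸s]≡ℓ^n = trans (sym (ℕ.^-distribˡ-+-* ℓ s (n ∸ s))) (cong (ℓ ^_) (ℕ.m+[n∸m]≡n s≤n))

DiagCond⇒ℓ^k∣-1 : ∀ {ℓ j k x} → 1 ≤ k → k ≤ j → DiagCond ℓ j x → + (ℓ ^ k) ∣ x - + 1
DiagCond⇒ℓ^k∣-1 {ℓ} {suc j} _ k≤j ℓ^j∣x-1 = ∣ᵤ⇒∣ (ℕ.∣-trans (^-monoʳ-∣ ℓ k≤j) ℓ^j∣x-1)
DiagCond⇒ℓ^k∣-1 {j = zero} (s≤s z≤n) ()

ℓ^n∣[a+1]² : ∀ {ℓ n r s} γ → s ≤ n → ΓG ℓ n r s γ → trace γ ≡ - + 2 →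
  + (ℓ ^ n) ∣ (a γ ℤ.+ + 1) ℤ.* (a γ ℤ.+ + 1)
ℓ^n∣[a+1]² {ℓ} {n} γ s≤n (det≡1 , _ , ℓ^s∣b , ℓ^[n∸s]∣c , _) tr≡-2 =
  subst (+ (ℓ ^ n) ∣_) (ℤ.neg-involutive _)
    (∣m⇒∣-m (subst (+ (ℓ ^ n) ∣_) (b*c≡-[a+1]² γ det≡1 tr≡-2)
      (offConds⇒ℓ^n∣* {x = b γ} {y = c γ} s≤n ℓ^s∣b ℓ^[n∸s]∣c)))

ℓ^k∣a+1∓2 : ∀ {ℓ n r k} γ → trace γ ≡ - + 2 → 1 ≤ k → k + k ≤ suc n →
  DiagCond ℓ r (a γ) → DiagCond ℓ (n ∸ r) (d γ) →
  + (ℓ ^ k) ∣ (a γ ℤ.+ + 1) - + 2 ⊎ + (ℓ ^ k) ∣ (a γ ℤ.+ + 1) ℤ.+ + 2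
ℓ^k∣a+1∓2 {ℓ} {r = r} {k = k} (mat A B C D) tr≡-2 1≤k 2k≤1+n diagA diagD
  with k≤r⊎k≤n∸r r 2k≤1+n
... | inj₁ k≤r = inj₁ (subst (+ (ℓ ^ k) ∣_) A-1≡ (DiagCond⇒ℓ^k∣-1 1≤k k≤r diagA))
  where
  A-1≡ : A - + 1 ≡ (A ℤ.+ + 1) - + 2
  A-1≡ = solve (A ∷ [])
... | inj₂ k≤n∸r =
  inj₂ (subst (+ (ℓ ^ k) ∣_) -[D-1]≡ (∣m⇒∣-m (DiagCond⇒ℓ^k∣-1 1≤k k≤n∸r diagD)))
  where
  open ≡-Reasoning
  -[D-1]≡ : - (D - + 1) ≡ (A ℤ.+ + 1) ℤ.+ + 2
  -[D-1]≡ = begin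
    - (D - + 1)                         ≡⟨ solve (D ∷ []) ⟩
    - + 2 ℤ.+ + 2 - (D - + 1)           ≡⟨ cong (λ t → t ℤ.+ + 2 - (D - + 1)) tr≡-2 ⟨
    (A ℤ.+ D) ℤ.+ + 2 - (D - + 1)       ≡⟨ solve (A ∷ D ∷ []) ⟩
    (A ℤ.+ + 1) ℤ.+ + 2                 ∎

∣y∧∣y∓2⇒∣2 : ∀ {m y} → m ∣ y → m ∣ y - + 2 ⊎ m ∣ y ℤ.+ + 2 → m ∣ + 2
∣y∧∣y∓2⇒∣2 m∣y (inj₁ m∣y-2) = ∣m⇒∣-m (∣m+n∣m⇒∣n m∣y-2 m∣y)
∣y∧∣y∓2⇒∣2 m∣y (inj₂ m∣y+2) = ∣m+n∣m⇒∣n m∣y+2 m∣y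

prime∣² : ∀ {p y} → Prime p → + p ∣ y ℤ.* y → + p ∣ y
prime∣² {p} {y} p-prime p∣y² with euclidsLemma ℤ.∣ y ∣ ℤ.∣ y ∣ p-prime
  (subst (p ℕ.∣_) (ℤ.abs-* y y) (∣⇒∣ᵤ p∣y²))
... | inj₁ p∣y = ∣ᵤ⇒∣ p∣y
... | inj₂ p∣y = ∣ᵤ⇒∣ p∣y

prime∣2⇒≡2 : ∀ {p} → Prime p → p ℕ.∣ 2 → p ≡ 2
prime∣2⇒≡2 p-prime p∣2 with irreducible[2] p∣2
... | inj₁ refl = ⊥-elim (¬prime[1] p-prime)
... | inj₂ p≡2 = p≡2

4∣y∓2⇒4∣y+2 : ∀ {y} → + 4 ∣ y - + 2 ⊎ + 4 ∣ y ℤ.+ + 2 → + 4 ∣ y ℤ.+ + 2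
4∣y∓2⇒4∣y+2 {y} (inj₁ 4∣y-2) = subst (+ 4 ∣_) y-2+4≡y+2 (∣m∣n⇒∣m+n 4∣y-2 (∣-refl {+ 4}))
  where
  y-2+4≡y+2 : y - + 2 ℤ.+ + 4 ≡ y ℤ.+ + 2
  y-2+4≡y+2 = solve (y ∷ [])
4∣y∓2⇒4∣y+2 (inj₂ 4∣y+2) = 4∣y+2

4∣y+2⇒8∤y² : ∀ y → + 4 ∣ y ℤ.+ + 2 → ¬ (+ 8 ∣ y ℤ.* y)
4∣y+2⇒8∤y² y (divides q y+2≡q*4) 8∣y² = 8∤4 (∣⇒∣ᵤ 8∣4)
  where
  open ≡-Reasoning
  y²-4≡ : y ℤ.* y - + 4 ≡ (+ 2 ℤ.* q ℤ.* q - + 2 ℤ.* q) ℤ.* + 8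
  y²-4≡ = begin
    y ℤ.* y - + 4
      ≡⟨ solve (y ∷ []) ⟩
    (y ℤ.+ + 2) ℤ.* (y ℤ.+ + 2) - + 4 ℤ.* (y ℤ.+ + 2)
      ≡⟨ cong (λ t → t ℤ.* t - + 4 ℤ.* t) y+2≡q*4 ⟩
    (q ℤ.* + 4) ℤ.* (q ℤ.* + 4) - + 4 ℤ.* (q ℤ.* + 4)
      ≡⟨ solve (q ∷ []) ⟩
    (+ 2 ℤ.* q ℤ.* q - + 2 ℤ.* q) ℤ.* + 8
      ∎
  8∣4 : + 8 ∣ + 4
  8∣4 = ∣m⇒∣-m (∣m+n∣m⇒∣n (divides (+ 2 ℤ.* q ℤ.* q - + 2 ℤ.* q) y²-4≡) 8∣y²)
  8∤4 : ¬ 8 ℕ.∣ 4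
  8∤4 8∣4 with ℕ.∣⇒≤ 8∣4
  ... | s≤s (s≤s (s≤s (s≤s ())))

2∤1 : ¬ 2 ℕ.∣ 1
2∤1 2∣1 with ℕ.∣⇒≤ 2∣1
... | s≤s ()

DiagCond₂-neg1 : ∀ {j} → j ≤ 1 → DiagCond 2 j (- + 1)
DiagCond₂-neg1 {zero} _ = 2∤1
DiagCond₂-neg1 {suc zero} _ = ℕ.∣-refl
DiagCond₂-neg1 {suc (suc _)} (s≤s ())

negI∈ΓG₂ : ∀ {n r s} → r ≤ 1 → n ∸ r ≤ 1 → ΓG 2 n r s negI
negI∈ΓG₂ r≤1 n∸r≤1 =
  refl , DiagCond₂-neg1 r≤1 , _ ℕ.∣0 , _ ℕ.∣0 , DiagCond₂-neg1 n∸r≤1 , 2∤1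

r≤1∧n∸r≤1 : ∀ {n r s} → 1 ≤ n → n ≤ 2 → r + s ≤ n → ¬ (2 ^ n ≡ 4 × r * s ≡ 0) →
  r ≤ 1 × n ∸ r ≤ 1
r≤1∧n∸r≤1 {1} {r} _ _ r+s≤1 _ = ℕ.m+n≤o⇒m≤o r r+s≤1 , ℕ.m∸n≤m 1 r
r≤1∧n∸r≤1 {2} {0} _ _ _ exceptional = ⊥-elim (exceptional (refl , refl))
r≤1∧n∸r≤1 {2} {1} _ _ _ _ = s≤s z≤n , s≤s z≤n
r≤1∧n∸r≤1 {2} {2} {0} _ _ _ exceptional = ⊥-elim (exceptional (refl , refl))
r≤1∧n∸r≤1 {2} {2} {suc _} _ _ (s≤s (s≤s ())) _
r≤1∧n∸r≤1 {2} {suc (suc (suc _))} _ _ (s≤s (s≤s ())) _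
r≤1∧n∸r≤1 {suc (suc (suc _))} _ (s≤s (s≤s ())) _ _

trace≡-2⇒ℓ≡2 : ∀ {ℓ n r s} γ → Prime ℓ → 1 ≤ n → s ≤ n →
  ΓG ℓ n r s γ → trace γ ≡ - + 2 → ℓ ≡ 2
trace≡-2⇒ℓ≡2 {ℓ} {suc n} γ ℓ-prime (s≤s z≤n) s≤n
  γ∈Γ@(_ , diagA , _ , _ , diagD , _) tr≡-2 =
  prime∣2⇒≡2 ℓ-prime (∣⇒∣ᵤ (∣y∧∣y∓2⇒∣2 ℓ∣a+1 ℓ∣a+1∓2))
  where
  ℓ∣a+1 : + ℓ ∣ a γ ℤ.+ + 1
  ℓ∣a+1 = prime∣² ℓ-prime (∣-trans (∣ᵤ⇒∣ (ℕ.m∣m*n (ℓ ^ n))) (ℓ^n∣[a+1]² γ s≤n γ∈Γ tr≡-2))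
  ℓ∣a+1∓2 : + ℓ ∣ (a γ ℤ.+ + 1) - + 2 ⊎ + ℓ ∣ (a γ ℤ.+ + 1) ℤ.+ + 2
  ℓ∣a+1∓2 = Sum.map (∣-trans ℓ∣ℓ¹) (∣-trans ℓ∣ℓ¹)
    (ℓ^k∣a+1∓2 {k = 1} γ tr≡-2 ℕ.≤-refl (s≤s (s≤s z≤n)) diagA diagD)
    where
    ℓ∣ℓ¹ : + ℓ ∣ + (ℓ ^ 1)
    ℓ∣ℓ¹ = ∣ᵤ⇒∣ (ℕ.m∣m*n 1)

trace≡-2⇒negI∈ΓG₂ : ∀ {n r s} γ → 1 ≤ n → s ≤ n → r + s ≤ n →
  ¬ (2 ^ n ≡ 4 × r * s ≡ 0) → ΓG 2 n r s γ → trace γ ≡ - + 2 → ΓG 2 n r s negI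
trace≡-2⇒negI∈ΓG₂ {n} {r} {s} γ 1≤n s≤n r+s≤n exceptional
  γ∈Γ@(_ , diagA , _ , _ , diagD , _) tr≡-2 with n ≤? 2
... | yes n≤2 = Product.uncurry (negI∈ΓG₂ {s = s}) (r≤1∧n∸r≤1 1≤n n≤2 r+s≤n exceptional)
... | no n≰2 = ⊥-elim (4∣y+2⇒8∤y² (a γ ℤ.+ + 1) 4∣a+3 8∣[a+1]²)
  where
  8∣[a+1]² : + 8 ∣ (a γ ℤ.+ + 1) ℤ.* (a γ ℤ.+ + 1)
  8∣[a+1]² = ∣-trans (∣ᵤ⇒∣ (^-monoʳ-∣ 2 (≰⇒> n≰2))) (ℓ^n∣[a+1]² {r = r} γ s≤n γ∈Γ tr≡-2)
  4∣a+3 : + 4 ∣ (a γ ℤ.+ + 1) ℤ.+ + 2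
  4∣a+3 = 4∣y∓2⇒4∣y+2 {a γ ℤ.+ + 1}
    (ℓ^k∣a+1∓2 {k = 2} γ tr≡-2 (s≤s z≤n) (s≤s (≰⇒> n≰2)) diagA diagD)

trace≡-2⇒negI∈ΓG : ∀ {ℓ n r s} γ → Prime ℓ → 1 ≤ n → s ≤ n → r + s ≤ n →
  ¬ (ℓ ^ n ≡ 4 × r * s ≡ 0) → ΓG ℓ n r s γ → trace γ ≡ - + 2 → ΓG ℓ n r s negI
trace≡-2⇒negI∈ΓG γ ℓ-prime 1≤n s≤n r+s≤n exceptional γ∈Γ tr≡-2
  with trace≡-2⇒ℓ≡2 γ ℓ-prime 1≤n s≤n γ∈Γ tr≡-2
... | refl = trace≡-2⇒negI∈ΓG₂ γ 1≤n s≤n r+s≤n exceptional γ∈Γ tr≡-2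

lemma3p1p2 : (ℓ n r s : ℕ) → Prime ℓ → 1 ≤ n → r ≤ n → s ≤ n → r + s ≤ n →
    ¬ (ℓ ^ n ≡ 4 × r * s ≡ 0) →
    (α : M2) → det α ≡ + 1 → ¬ IrregularCusp (ΓG ℓ n r s) α
lemma3p1p2 ℓ n r s ℓ-prime 1≤n _ s≤n r+s≤n exceptional α det≡1
  (negI∉Γ , h , _ , stabiliser) =
  negI∉Γ (trace≡-2⇒negI∈ΓG γ ℓ-prime 1≤n s≤n r+s≤n exceptional γ∈Γ tr≡-2)
  where
  γ : M2
  γ = α · (negT h · inv α)
  γ∈Γ : ΓG ℓ n r s γ
  γ∈Γ = proj₁ (proj₂ (stabiliser (negT h) (det-negT h)) (negT∈⟨negT⟩ h))
  tr≡-2 : trace γ ≡ - + 2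
  tr≡-2 = trans (trace-conj α (negT h)) (cong (ℤ._* - + 2) det≡1)
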